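{- Let $G$ be a graph. If $\chi(G) \geq 3T(G)$, then $T_t(G) = \chi(G)$.
   Context: All graphs are finite and simple. A tessellation of a graph $G=(V,E)$ is a partition of $V$ into cliques (called tiles); an edge belongs to the tessellation if both its endpoints lie in the same tile. A $k$-tessellation cover of $G$ is a set of $k$ tessellations whose edges together cover $E$; $T(G)$ denotes the minimum $k$ for which $G$ has a $k$-tessellation cover. Equivalently, with $\Sigma=\{1,\dots,k\}$, a $k$-tessellation cover is a map $h$ assigning to each edge a nonempty subset of $\Sigma$ such that for each label $i$ the edges whose subset contains $i$ are exactly the edges of a tessellation. A $k$-total tessellation cover of $G$ is a pair $(f,h)$ where $f:V\to\Sigma$ is a proper vertex coloring and $h$ is a $k$-tessellation cover with labels in $\Sigma$, such that every edge $uv$ satisfies $f(u)\notin h(uv)$ and $f(v)\notin h(uv)$. The total tessellation cover number $T_t(G)$ is the minimum $k$ for which $G$ has a $k$-total tessellation cover. $\chi(G)$ is the chromatic number. -}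

module Defs where

open import Data.Nat using (ℕ; _≤_)
open import Data.Fin using (Fin)
open import Data.Bool using (Bool; true; false)
open import Data.Product using (Σ; _×_; ∃)
open import Relation.Binary.PropositionalEquality using (_≡_; _≢_)

record Graph (n : ℕ) : Set where
  field
    adj   : Fin n → Fin n → Bool
    sym   : ∀ u v → adj u v ≡ adj v u
    irrefl : ∀ v → adj v v ≡ false

open Graph public

Edge : ∀ {n} → Graph n → Fin n → Fin n → Set
Edge G u v = adj G u v ≡ true

IsMin : (ℕ → Set) → ℕ → Set
IsMin P k = P k × (∀ m → P m → k ≤ m)

ProperColoring : ∀ {n} → Graph n → (k : ℕ) → (Fin n → Fin k) → Set
ProperColoring G k f = ∀ u v → Edge G u v → f u ≢ f v

Colorable : ∀ {n} → Graph n → ℕ → Set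
Colorable G k = Σ (Fin _ → Fin k) (ProperColoring G k)

IsChromaticNumber : ∀ {n} → Graph n → ℕ → Set
IsChromaticNumber G = IsMin (Colorable G)

-- A tessellation: a partition of V into tiles, given by a tile label for each
-- vertex (vertices with equal labels lie in the same tile); every tile is a clique.
IsTessellation : ∀ {n} → Graph n → (Fin n → ℕ) → Set
IsTessellation G t = ∀ u v → u ≢ v → t u ≡ t v → Edge G u v

InTess : ∀ {n} → (Fin n → ℕ) → Fin n → Fin n → Set
InTess t u v = t u ≡ t v

TessCover : ∀ {n} → Graph n → (k : ℕ) → (Fin k → Fin n → ℕ) → Set
TessCover G k T =
  (∀ i → IsTessellation G (T i)) ×
  (∀ u v → Edge G u v → ∃ λ i → InTess (T i) u v)

HasTessCover : ∀ {n} → Graph n → ℕ → Set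
HasTessCover G k = Σ (Fin k → Fin _ → ℕ) (TessCover G k)

IsTessCoverNumber : ∀ {n} → Graph n → ℕ → Set
IsTessCoverNumber G = IsMin (HasTessCover G)

-- A k-total tessellation cover (f, T): f a proper colouring with labels in
-- Σ = Fin k, T a k-tessellation cover whose i-th tessellation carries label i,
-- and for each edge uv, neither f u nor f v is a label of uv
-- (i.e. uv is not an edge of tessellation f u nor of tessellation f v).
TotalTessCover : ∀ {n} → Graph n → (k : ℕ) → (Fin n → Fin k) → (Fin k → Fin n → ℕ) → Set
TotalTessCover G k f T =
  ProperColoring G k f ×
  TessCover G k T ×
  (∀ u v → Edge G u v → (InTess (T (f u)) u v → Data.Empty.⊥) × (InTess (T (f v)) u v → Data.Empty.⊥))
  where import Data.Empty

HasTotalTessCover : ∀ {n} → Graph n → ℕ → Set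
HasTotalTessCover G k = Σ (Fin _ → Fin k) λ f → Σ (Fin k → Fin _ → ℕ) (TotalTessCover G k f)

IsTotalTessCoverNumber : ∀ {n} → Graph n → ℕ → Set
IsTotalTessCoverNumber G = IsMin (HasTotalTessCover G)

-- Take a proper χ-colouring f and a T-tessellation cover. Give each tessellation
-- of the cover its own block of three colours; the tessellation labelled by a
-- colour ℓ is that of its block, with every vertex of colour ℓ cut out into a
-- singleton tile, so no edge at a vertex of colour ℓ carries label ℓ. An edge uv
-- lying in tessellation i survives under the colour of block i that is neither
-- f u nor f v, which exists because the block has three colours. Conversely the
-- colouring of a total tessellation cover is proper, so T_t(G) ≥ χ(G).
module Submission where

open import Defs hiding (sym)
open import Data.Nat using (ℕ; suc; _≤_; _<_; _*_; _<?_)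
open import Data.Nat.Properties using (*-comm; *-cancelˡ-≡; suc-injective; even≢odd)
open import Data.Fin using (Fin; toℕ; fromℕ<; inject≤; combine; remQuot; _≟_)
open import Data.Fin.Patterns using (0F; 1F; 2F)
open import Data.Fin.Properties
  using (toℕ-injective; toℕ-fromℕ<; toℕ-inject≤; toℕ<n; inject≤-injective; combine-injectiveʳ; remQuot-combine)
open import Data.Product using (_×_; _,_; proj₁; ∃)
open import Data.Empty using (⊥-elim)
open import Function using (_∘_)
open import Function.Definitions using (Injective)
open import Relation.Nullary using (yes; no; ¬_; contradiction)
open import Relation.Binary.Definitions using (DecidableEquality)
open import Relation.Binary.PropositionalEquality using (_≡_; _≢_; refl; sym; trans; cong; subst)

edge⇒≢ : ∀ {n} (G : Graph n) {u v} → Edge G u v → u ≢ v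
edge⇒≢ G {u} uv refl with trans (sym uv) (irrefl G u)
... | ()

discrete-isTessellation : ∀ {n} (G : Graph n) → IsTessellation G toℕ
discrete-isTessellation G u v u≢v eq = contradiction (toℕ-injective eq) u≢v

avoid-two : ∀ {a} {A : Set a} → DecidableEquality A → (g : Fin 3 → A) → Injective _≡_ _≡_ g →
  ∀ x y → ∃ λ r → g r ≢ x × g r ≢ y
avoid-two _≟ᴬ_ g g-inj x y with g 0F ≟ᴬ x | g 0F ≟ᴬ y
... | no g0≢x | no g0≢y = 0F , g0≢x , g0≢y
... | yes refl | _ with g 1F ≟ᴬ y
...   | no g1≢y = 1F , (λ ()) ∘ g-inj , g1≢y
...   | yes refl = 2F , (λ ()) ∘ g-inj , (λ ()) ∘ g-inj
avoid-two _≟ᴬ_ g g-inj x y | no _ | yes refl with g 1F ≟ᴬ x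
...   | no g1≢x = 1F , g1≢x , (λ ()) ∘ g-inj
...   | yes refl = 2F , (λ ()) ∘ g-inj , (λ ()) ∘ g-inj

-- Cut the vertices of colour ℓ out of t: they get pairwise distinct odd labels,
-- the other vertices keep their tile of t under an even label.
isolate : ∀ {n k} → (Fin n → Fin k) → Fin k → (Fin n → ℕ) → Fin n → ℕ
isolate f ℓ t v with f v ≟ ℓ
... | yes _ = suc (2 * toℕ v)
... | no _ = 2 * t v

module _ {n k} (f : Fin n → Fin k) (ℓ : Fin k) (t : Fin n → ℕ) where

  private
    odd-injective : ∀ {u v : Fin n} → suc (2 * toℕ u) ≡ suc (2 * toℕ v) → u ≡ v
    odd-injective eq = toℕ-injective (*-cancelˡ-≡ _ _ 2 (suc-injective eq))

  isolate-isTessellation : (G : Graph n) → IsTessellation G t → IsTessellation G (isolate f ℓ t)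
  isolate-isTessellation G t-tess u v u≢v eq with f u ≟ ℓ | f v ≟ ℓ
  ... | yes _ | yes _ = contradiction (odd-injective eq) u≢v
  ... | yes _ | no _ = ⊥-elim (even≢odd (t v) (toℕ u) (sym eq))
  ... | no _ | yes _ = ⊥-elim (even≢odd (t u) (toℕ v) eq)
  ... | no _ | no _ = t-tess u v u≢v (*-cancelˡ-≡ _ _ 2 eq)

  isolate-separates : ∀ {u v} → f u ≡ ℓ → u ≢ v → ¬ InTess (isolate f ℓ t) u v
  isolate-separates {u} {v} fu≡ℓ u≢v eq with f u ≟ ℓ | f v ≟ ℓ
  ... | no fu≢ℓ | _ = fu≢ℓ fu≡ℓ
  ... | yes _ | yes _ = u≢v (odd-injective eq)
  ... | yes _ | no _ = even≢odd (t v) (toℕ u) (sym eq)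

  isolate-preserves : ∀ {u v} → f u ≢ ℓ → f v ≢ ℓ → InTess t u v → InTess (isolate f ℓ t) u v
  isolate-preserves {u} {v} fu≢ℓ fv≢ℓ eq with f u ≟ ℓ | f v ≟ ℓ
  ... | yes fu≡ℓ | _ = contradiction fu≡ℓ fu≢ℓ
  ... | no _ | yes fv≡ℓ = contradiction fv≡ℓ fv≢ℓ
  ... | no _ | no _ = cong (2 *_) eq

isolation-totalTessCover : ∀ {n k} (G : Graph n) (f : Fin n → Fin k) → ProperColoring G k f →
  (tess : Fin k → Fin n → ℕ) → (∀ ℓ → IsTessellation G (tess ℓ)) →
  (∀ u v → Edge G u v → ∃ λ ℓ → f u ≢ ℓ × f v ≢ ℓ × InTess (tess ℓ) u v) →
  HasTotalTessCover G k
isolation-totalTessCover {n} {k} G f proper tess tess-isTess survives =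
  f , isolated , proper , (isolated-isTess , covers) , separates
  where
    isolated : Fin k → Fin n → ℕ
    isolated ℓ = isolate f ℓ (tess ℓ)

    isolated-isTess : ∀ ℓ → IsTessellation G (isolated ℓ)
    isolated-isTess ℓ = isolate-isTessellation f ℓ (tess ℓ) G (tess-isTess ℓ)

    covers : ∀ u v → Edge G u v → ∃ λ ℓ → InTess (isolated ℓ) u v
    covers u v uv with survives u v uv
    ... | ℓ , fu≢ℓ , fv≢ℓ , in-tess = ℓ , isolate-preserves f ℓ (tess ℓ) fu≢ℓ fv≢ℓ in-tess

    separates : ∀ u v → Edge G u v → ¬ InTess (isolated (f u)) u v × ¬ InTess (isolated (f v)) u v
    separates u v uv =
      isolate-separates f (f u) (tess (f u)) refl (edge⇒≢ G uv) ,
      isolate-separates f (f v) (tess (f v)) refl (edge⇒≢ G uv ∘ sym) ∘ sym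

module _ {T k : ℕ} (3T≤k : T * 3 ≤ k) where

  blockColour : Fin T → Fin 3 → Fin k
  blockColour i r = inject≤ (combine i r) 3T≤k

  blockColour-injective : ∀ i → Injective _≡_ _≡_ (blockColour i)
  blockColour-injective i {r} {s} eq =
    combine-injectiveʳ i r i s (inject≤-injective 3T≤k 3T≤k (combine i r) (combine i s) eq)

blockTess : ∀ {n T k} → (Fin T → Fin n → ℕ) → Fin k → Fin n → ℕ
blockTess {T = T} tess ℓ with toℕ ℓ <? T * 3
... | yes ℓ<3T = tess (proj₁ (remQuot 3 (fromℕ< ℓ<3T)))
... | no _ = toℕ

blockTess-isTessellation : ∀ {n T k} (G : Graph n) (tess : Fin T → Fin n → ℕ) →
  (∀ i → IsTessellation G (tess i)) → ∀ (ℓ : Fin k) → IsTessellation G (blockTess tess ℓ)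
blockTess-isTessellation {T = T} G tess tess-isTess ℓ with toℕ ℓ <? T * 3
... | yes ℓ<3T = tess-isTess (proj₁ (remQuot 3 (fromℕ< ℓ<3T)))
... | no _ = discrete-isTessellation G

blockTess-blockColour : ∀ {n T k} (3T≤k : T * 3 ≤ k) (tess : Fin T → Fin n → ℕ) i r →
  blockTess tess (blockColour 3T≤k i r) ≡ tess i
blockTess-blockColour {T = T} 3T≤k tess i r with toℕ (blockColour 3T≤k i r) <? T * 3
... | yes ℓ<3T = cong (tess ∘ proj₁) (trans (cong (remQuot 3) fromℕ<≡combine) (remQuot-combine i r))
  where
    fromℕ<≡combine : fromℕ< ℓ<3T ≡ combine i r
    fromℕ<≡combine = toℕ-injective (trans (toℕ-fromℕ< ℓ<3T) (toℕ-inject≤ (combine i r) 3T≤k))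
... | no ℓ≮3T = contradiction (subst (_< T * 3) (sym (toℕ-inject≤ (combine i r) 3T≤k)) (toℕ<n (combine i r))) ℓ≮3T

tessCover⇒totalTessCover : ∀ {n T k} (G : Graph n) (f : Fin n → Fin k) → ProperColoring G k f →
  (tess : Fin T → Fin n → ℕ) → TessCover G T tess → T * 3 ≤ k → HasTotalTessCover G k
tessCover⇒totalTessCover G f proper tess (tess-isTess , covered) 3T≤k =
  isolation-totalTessCover G f proper (blockTess tess)
    (blockTess-isTessellation G tess tess-isTess) survives
  where
    survives : ∀ u v → Edge G u v → ∃ λ ℓ → f u ≢ ℓ × f v ≢ ℓ × InTess (blockTess tess ℓ) u v
    survives u v uv with covered u v uv
    ... | i , in-tess with avoid-two _≟_ (blockColour 3T≤k i) (blockColour-injective 3T≤k i) (f u) (f v)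
    ...   | r , ℓ≢fu , ℓ≢fv =
      blockColour 3T≤k i r , ℓ≢fu ∘ sym , ℓ≢fv ∘ sym ,
      subst (λ t → InTess t u v) (sym (blockTess-blockColour 3T≤k tess i r)) in-tess

totalTessCover⇒colorable : ∀ {n k} (G : Graph n) → HasTotalTessCover G k → Colorable G k
totalTessCover⇒colorable G (f , _ , proper , _) = f , proper

lemma1 : ∀ {n} (G : Graph n) (χ T : ℕ) →
    IsChromaticNumber G χ → IsTessCoverNumber G T →
    3 * T ≤ χ → IsTotalTessCoverNumber G χ
lemma1 G χ T ((f , proper) , χ-minimal) ((tess , cover) , _) 3T≤χ =
  tessCover⇒totalTessCover G f proper tess cover (subst (_≤ χ) (*-comm 3 T) 3T≤χ) ,
  λ m total → χ-minimal m (totalTessCover⇒colorable G total)
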